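{- In a tiling, if $\beta\gamma\delta$ is the only vertex type containing $\beta$ (equivalently, containing $\gamma$, or containing $\delta$), then every other vertex is of type $\alpha^a$ with $a\ge3$.
   Context: A tiling is an edge-to-edge tiling of the unit sphere by $f$ congruent simple spherical quadrilaterals, with great-circle edges and every vertex of degree $\ge 3$. The tile is $ABCD$ with $AB=AD=a$, $BC=b$, $CD=c$, where $a,b,c$ are pairwise distinct. Its angles are $\alpha,\beta,\gamma,\delta$ at $A,B,C,D$. The angles are treated as four distinct labels. $\beta\gamma\delta$ is the vertex with one copy each of $\beta,\gamma,\delta$; $\alpha^a$ is a vertex of $a$ copies of $\alpha$. -}

module Defs where

open import Data.Nat using (ℕ; _+_; _≥_)
open import Data.Fin using (Fin)
open import Data.Fin.Properties using (_≟_)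
open import Data.List using (length; filter; allFin)
open import Data.Product using (_×_)
open import Data.Sum using (_⊎_)
open import Relation.Binary.PropositionalEquality using (_≡_)

-- The four angle labels α, β, γ, δ of the tile ABCD (at A, B, C, D).
data Angle : Set where
  α β γ δ : Angle

-- Combinatorial (corner–vertex incidence) data of a tiling by f congruent
-- quadrilaterals: tile t has one corner with each angle label, and
-- 'vertexAt t X' is the vertex of the tiling at which the corner of tile t
-- carrying angle X lies.  Every vertex has degree ≥ 3, where the degree of a
-- vertex of an edge-to-edge tiling is the number of tile corners at it.
record Tiling : Set where
  field
    f        : ℕ
    V        : ℕ
    vertexAt : Fin f → Angle → Fin V

  count : Angle → Fin V → ℕ
  count X v = length (filter (λ t → vertexAt t X ≟ v) (allFin f))

  degree : Fin V → ℕ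
  degree v = count α v + count β v + count γ v + count δ v

  field
    degree≥3 : ∀ v → degree v ≥ 3

  IsBγδ : Fin V → Set
  IsBγδ v = count α v ≡ 0 × count β v ≡ 1 × count γ v ≡ 1 × count δ v ≡ 1

  IsAlphaPow≥3 : Fin V → Set
  IsAlphaPow≥3 v = count β v ≡ 0 × count γ v ≡ 0 × count δ v ≡ 0 × count α v ≥ 3

  Contains : Angle → Fin V → Set
  Contains X v = count X v ≥ 1

-- Each angle label occurs at exactly one corner of every tile, so summed over all vertices
-- the counts of β, γ and δ are all equal to f.  If β only occurs at βγδ, then count β ≤ count γ
-- at every vertex, and equal totals force equality everywhere; likewise for δ.  Hence a vertex
-- without β has neither γ nor δ, and its degree ≥ 3 is made up of α's alone.
module Submission where

open import Defs
open import Data.Fin using (Fin; zero; suc; punchIn)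
open import Data.Fin.Properties using (_≟_; punchInᵢ≢i)
open import Data.Nat using (ℕ; zero; suc; _+_; _≤_; _≥_; z≤n; s≤s)
open import Data.Nat.Properties
  using (≤-reflexive; ≤-antisym; +-mono-≤; +-monoʳ-≤; +-cancelʳ-≤;
         +-identityʳ; n≢0⇒n>0; +-0-commutativeMonoid)
  renaming (_≟_ to _≟ℕ_)
open import Data.List using (List; []; _∷_; length; filter; allFin)
open import Data.List.Properties using (length-tabulate; filter-accept; filter-reject)
open import Data.Vec.Functional using (Vector; removeAt)
open import Data.Product using (_,_)
open import Data.Sum using (_⊎_; inj₁; inj₂)
open import Function using (_∘_)
open import Relation.Nullary using (yes; no)
open import Relation.Binary.PropositionalEquality
  using (_≡_; refl; sym; trans; cong; cong₂; subst; module ≡-Reasoning)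
open import Algebra.Properties.CommutativeMonoid.Sum +-0-commutativeMonoid
  using (sum; sum-cong-≗; sum-remove; sum-replicate-zero)

sum-mono-≤ : ∀ {n} {h k : Vector ℕ n} → (∀ i → h i ≤ k i) → sum h ≤ sum k
sum-mono-≤ {zero}  h≤k = z≤n
sum-mono-≤ {suc n} h≤k = +-mono-≤ (h≤k zero) (sum-mono-≤ (h≤k ∘ suc))

sum-≤-≡⇒≗ : ∀ {n} {h k : Vector ℕ n} → (∀ i → h i ≤ k i) → sum h ≡ sum k → ∀ i → h i ≡ k i
sum-≤-≡⇒≗ {suc n} {h} {k} h≤k Σh≡Σk i = ≤-antisym (h≤k i) kᵢ≤hᵢ
  where
  kᵢ≤hᵢ : k i ≤ h i
  kᵢ≤hᵢ = +-cancelʳ-≤ (sum (removeAt h i)) (k i) (h i) (begin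
    k i + sum (removeAt h i) ≤⟨ +-monoʳ-≤ (k i) (sum-mono-≤ (h≤k ∘ punchIn i)) ⟩
    k i + sum (removeAt k i) ≡⟨ sym (sum-remove k) ⟩
    sum k                    ≡⟨ sym Σh≡Σk ⟩
    sum h                    ≡⟨ sum-remove h ⟩
    h i + sum (removeAt h i) ∎)
    where open Data.Nat.Properties.≤-Reasoning

fibre-size : ∀ {A : Set} {n} → (A → Fin n) → List A → Fin n → ℕ
fibre-size g xs v = length (filter (λ x → g x ≟ v) xs)

sum-fibre-size : ∀ {A : Set} {n} (g : A → Fin n) (xs : List A) →
                 sum (fibre-size g xs) ≡ length xs
sum-fibre-size {n = n} g [] = sum-replicate-zero n
sum-fibre-size {n = zero}  g (x ∷ xs) with () ← g x
sum-fibre-size {n = suc n} g (x ∷ xs) = begin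
  sum (fibre-size g (x ∷ xs))
    ≡⟨ sum-remove (fibre-size g (x ∷ xs)) ⟩
  fibre-size g (x ∷ xs) (g x) + sum (removeAt (fibre-size g (x ∷ xs)) (g x))
    ≡⟨ cong₂ _+_ (cong length (filter-accept (λ y → g y ≟ g x) refl))
              (sum-cong-≗ (λ j → cong length (filter-reject (λ y → g y ≟ punchIn (g x) j)
                                                (punchInᵢ≢i (g x) j ∘ sym)))) ⟩
  suc (fibre-size g xs (g x) + sum (removeAt (fibre-size g xs) (g x)))
    ≡⟨ cong suc (sym (sum-remove (fibre-size g xs))) ⟩
  suc (sum (fibre-size g xs))
    ≡⟨ cong suc (sum-fibre-size g xs) ⟩
  suc (length xs) ∎
  where open ≡-Reasoning

≡-when-positive⇒≤ : ∀ {m n} → (1 ≤ m → m ≡ n) → m ≤ n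
≡-when-positive⇒≤ {zero}  _   = z≤n
≡-when-positive⇒≤ {suc m} m≡n = ≤-reflexive (m≡n (s≤s z≤n))

module _ (T : Tiling) where
  open Tiling T

  sum-count : ∀ X → sum (count X) ≡ f
  sum-count X = trans (sum-fibre-size (λ t → vertexAt t X) (allFin f)) (length-tabulate (λ t → t))

  count-≡-everywhere : ∀ X Y → (∀ v → Contains X v → count X v ≡ count Y v) →
                       ∀ v → count X v ≡ count Y v
  count-≡-everywhere X Y agree =
    sum-≤-≡⇒≗ (λ v → ≡-when-positive⇒≤ (agree v)) (trans (sum-count X) (sym (sum-count Y)))

  degree-without-βγδ : ∀ v → count β v ≡ 0 → count γ v ≡ 0 → count δ v ≡ 0 → degree v ≡ count α v
  degree-without-βγδ v β₀ γ₀ δ₀ rewrite β₀ | γ₀ | δ₀ =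
    trans (+-identityʳ _) (trans (+-identityʳ _) (+-identityʳ _))

lemma8 : (T : Tiling) → let open Tiling T in
    (∀ v → Contains β v → IsBγδ v) →
    ∀ v → IsBγδ v ⊎ IsAlphaPow≥3 v
lemma8 T onlyBγδ v with Tiling.count T β v ≟ℕ 0
... | no  β≢0 = inj₁ (onlyBγδ v (n≢0⇒n>0 β≢0))
... | yes β₀  = inj₂ (β₀ , γ₀ , δ₀ , subst (_≥ 3) (degree-without-βγδ T v β₀ γ₀ δ₀) (degree≥3 v))
  where
  open Tiling T
  β≡γ : ∀ w → count β w ≡ count γ w
  β≡γ = count-≡-everywhere T β γ (λ w βw → let (_ , β₁ , γ₁ , _) = onlyBγδ w βw in trans β₁ (sym γ₁))
  β≡δ : ∀ w → count β w ≡ count δ w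
  β≡δ = count-≡-everywhere T β δ (λ w βw → let (_ , β₁ , _ , δ₁) = onlyBγδ w βw in trans β₁ (sym δ₁))
  γ₀ : count γ v ≡ 0
  γ₀ = trans (sym (β≡γ v)) β₀
  δ₀ : count δ v ≡ 0
  δ₀ = trans (sym (β≡δ v)) β₀
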